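{- Let $M_1=(E_1,G_1)$ and $M_2=(E_2,G_2)$ be matroids and $M=M_1\otimes M_2$. Then (i) $M^c= M_1^c\otimes M_2^c$; (ii) for all flats $F_1$ of $G_1$ and $F_2$ of $G_2$, $M|\mathrm{cl}(F_1\cup F_2)=(M_1|F_1)\otimes(M_2|F_2)$; (iii) $\omega(M)=\omega(M_1)+\omega(M_2)$; and (iv) $\chi(M)=\chi(M_1)+\chi(M_2)$.
   Context: A matroid is a pair $M=(E,G)$ where $G$ is the set of nonzero vectors of a finite-dimensional $\mathbb F_2$-vector space $V(G)=G\cup\{0\}$ and $E\subseteq G$; $\dim(M)=\dim V(G)$. A flat of $G$ is a set $F\subseteq G$ with $F\cup\{0\}$ a subspace, of dimension that of the subspace. $\mathrm{cl}(X)$ is the set of nonzero vectors in the span of $X$. $M|F=(E\cap F,F)$. $M^c=(G\setminus E,G)$. $\omega(M)$ is the largest dimension of a flat contained in $E$; $\chi(M)=\dim(M)-\omega(M^c)$. Lift-join: $M_1\otimes M_2=(E_1\cup(E_2+V(G_1)),G_1\oplus G_2)$ where $G_1\oplus G_2$ is the set of nonzero vectors of $V(G_1)\oplus V(G_2)$, with each $V(G_i)$ (and hence each flat of $G_i$) identified with its copy, and $X+Y=\{x+y:x\in X,y\in Y\}$. -}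

module Defs where

open import Level using (0ℓ)
open import Data.Bool using (Bool; true; false; _xor_; if_then_else_)
open import Data.Nat using (ℕ; zero; suc; _+_; _∸_; _≤_)
open import Data.Vec using (Vec; []; _∷_; replicate; zipWith; take; drop)
open import Data.List using (List; foldr)
open import Data.List.Relation.Unary.All using (All)
open import Data.Product using (Σ; ∃; _×_; _,_)
open import Data.Sum using (_⊎_)
open import Relation.Binary.PropositionalEquality using (_≡_; _≢_)
open import Relation.Unary using (Pred; _⊆_; _≐_; _∪_; _∈_; _∉_)

𝔽₂^ : ℕ → Set
𝔽₂^ n = Vec Bool n

0v : ∀ {n} → 𝔽₂^ n
0v {n} = replicate n false

infixl 6 _+v_
_+v_ : ∀ {n} → 𝔽₂^ n → 𝔽₂^ n → 𝔽₂^ n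
_+v_ = zipWith _xor_

VSet : ℕ → Set₁
VSet n = Pred (𝔽₂^ n) 0ℓ

V : ∀ {n} → VSet n → VSet n
V G x = x ≡ 0v ⊎ G x

IsFlat : ∀ {n} → VSet n → Set
IsFlat F = (0v ∉ F) × (∀ x y → V F x → V F y → V F (x +v y))

IsFlatOf : ∀ {n} → VSet n → VSet n → Set
IsFlatOf F G = IsFlat F × F ⊆ G

lincomb : ∀ {n k} → Vec Bool k → Vec (𝔽₂^ n) k → 𝔽₂^ n
lincomb [] [] = 0v
lincomb (c ∷ cs) (b ∷ bs) = (if c then b else 0v) +v lincomb cs bs

HasDim : ∀ {n} → VSet n → ℕ → Set
HasDim {n} F k = Σ (Vec (𝔽₂^ n) k) λ b →
    (∀ c → lincomb c b ≡ 0v → c ≡ replicate k false)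
  × (∀ x → V F x → ∃ λ c → lincomb c b ≡ x)
  × (∀ c → V F (lincomb c b))

sumList : ∀ {n} → List (𝔽₂^ n) → 𝔽₂^ n
sumList = foldr _+v_ 0v

cl : ∀ {n} → VSet n → VSet n
cl X v = (∃ λ xs → All X xs × sumList xs ≡ v) × v ≢ 0v

-- A matroid M = (E, G) whose ground set G is a flat of the ambient space F₂ⁿ
-- (every finite-dimensional F₂-space is realised this way).
record Matroid (n : ℕ) : Set₁ where
  constructor mat
  field
    E : VSet n
    G : VSet n
open Matroid public

IsMatroid : ∀ {n} → Matroid n → Set
IsMatroid M = IsFlat (G M) × E M ⊆ G M

_≈M_ : ∀ {n} → Matroid n → Matroid n → Set
M ≈M N = (E M ≐ E N) × (G M ≐ G N)

_ᶜ : ∀ {n} → Matroid n → Matroid n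
M ᶜ = mat (λ x → G M x × x ∉ E M) (G M)

_∣_ : ∀ {n} → Matroid n → VSet n → Matroid n
M ∣ F = mat (λ x → E M x × F x) F

-- V(G₁) ⊕ V(G₂) realised as F₂^(n₁+n₂), v = (take n₁ v, drop n₁ v)
fst : ∀ {n₁ n₂} → 𝔽₂^ (n₁ + n₂) → 𝔽₂^ n₁
fst {n₁} = take n₁

snd : ∀ {n₁ n₂} → 𝔽₂^ (n₁ + n₂) → 𝔽₂^ n₂
snd {n₁} = drop n₁

ι₁ : ∀ {n₁ n₂} → VSet n₁ → VSet (n₁ + n₂)
ι₁ {n₁} {n₂} X v = snd {n₁} {n₂} v ≡ 0v × X (fst {n₁} {n₂} v)

ι₂ : ∀ {n₁ n₂} → VSet n₂ → VSet (n₁ + n₂)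
ι₂ {n₁} {n₂} X v = fst {n₁} {n₂} v ≡ 0v × X (snd {n₁} {n₂} v)

_⊕G_ : ∀ {n₁ n₂} → VSet n₁ → VSet n₂ → VSet (n₁ + n₂)
_⊕G_ {n₁} {n₂} G₁ G₂ v =
  V G₁ (fst {n₁} {n₂} v) × V G₂ (snd {n₁} {n₂} v) × v ≢ 0v

_+S_ : ∀ {n} → VSet n → VSet n → VSet n
(X +S Y) v = ∃ λ x → ∃ λ y → X x × Y y × v ≡ x +v y

-- lift-join M₁ ⊗ M₂ = (E₁ ∪ (E₂ + V(G₁)), G₁ ⊕ G₂)
_⊗_ : ∀ {n₁ n₂} → Matroid n₁ → Matroid n₂ → Matroid (n₁ + n₂)
_⊗_ {n₁} {n₂} M₁ M₂ =
  mat (ι₁ {n₁} {n₂} (E M₁) ∪ (ι₂ {n₁} {n₂} (E M₂) +S ι₁ {n₁} {n₂} (V (G M₁))))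
      (G M₁ ⊕G G M₂)

IsOmega : ∀ {n} → Matroid n → ℕ → Set₁
IsOmega M k =
    (Σ (VSet _) λ F → IsFlat F × F ⊆ E M × HasDim F k)
  × (∀ (F : VSet _) j → IsFlat F → F ⊆ E M → HasDim F j → j ≤ k)

IsDim : ∀ {n} → Matroid n → ℕ → Set
IsDim M d = HasDim (G M) d

IsChi : ∀ {n} → Matroid n → ℕ → Set₁
IsChi M c = ∃ λ d → ∃ λ w → IsDim M d × IsOmega (M ᶜ) w × c ≡ d ∸ w

-- Write a vector of V(G₁) ⊕ V(G₂) as (a , b). Then (a , b) ∈ E(M₁ ⊗ M₂) iff either b = 0 and
-- a ∈ E₁, or b ∈ E₂ and a ∈ V(G₁); (i) and (ii) follow pointwise from this description, once
-- one knows that cl(F₁ ∪ F₂) = F₁ ⊕ F₂. For (iii), F₁ ⊕ F₂ is a flat inside E of dimension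
-- ω(M₁) + ω(M₂) when Fᵢ ⊆ Eᵢ realise ω(Mᵢ). Conversely, for a flat F ⊆ E the projection to
-- the second summand splits dim F into the dimension of its kernel, a flat inside E₁, and
-- of its image, a flat inside E₂. Finally (iv) combines (i), (iii) for the complements and
-- additivity of dimension; the truncated subtraction is exact because ω(Mᶜ) ≤ dim M.
module Submission where

open import Defs
open import Data.Bool using (Bool; true; false; _xor_; if_then_else_)
open import Data.Bool.Properties using (xor-assoc; xor-comm; xor-identityˡ; xor-identityʳ; xor-same)
  renaming (_≟_ to _≟B_)
open import Data.Nat using (ℕ; zero; suc; _+_; _∸_; _≤_; z≤n; s≤s)
open import Data.Nat.Properties using (+-mono-≤; +-suc; ∸-+-assoc; +-∸-comm; +-∸-assoc)
open import Data.Vec using (Vec; []; _∷_; take; drop; _++_; map)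
open import Data.Vec.Properties
  using (zipWith-assoc; zipWith-identityˡ; zipWith-identityʳ; zipWith-++; take-zipWith; drop-zipWith;
         take++drop≡id; ++-injectiveˡ; ++-injectiveʳ; ∷-injectiveʳ; ≡-dec)
open import Data.List as List using (List; []; _∷_)
open import Data.List.Relation.Unary.All using (All; []; _∷_)
open import Data.List.Relation.Unary.All.Properties using (++⁺)
open import Data.Vec.Relation.Unary.All as VecAll using ([]; _∷_)
open import Data.Vec.Relation.Unary.All.Properties using (map⁺)
open import Data.Product using (Σ; ∃; _×_; _,_; proj₁; proj₂)
open import Data.Sum using (_⊎_; inj₁; inj₂; [_,_])
open import Data.Empty using (⊥-elim)
open import Function using (_∘_)
open import Relation.Nullary using (¬_; Dec; yes; no)
open import Relation.Nullary.Decidable using (map′; _⊎-dec_)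
open import Level using (0ℓ)
open import Relation.Unary using (Pred; _⊆_; _≐_; _∪_)
open import Relation.Unary.Properties using (≐-sym)
open import Relation.Binary.PropositionalEquality hiding ([_])

private
  variable
    n m k d : ℕ

-- Linear algebra over 𝔽₂

+v-assoc : (x y z : 𝔽₂^ n) → (x +v y) +v z ≡ x +v (y +v z)
+v-assoc = zipWith-assoc xor-assoc

+v-comm : (x y : 𝔽₂^ n) → x +v y ≡ y +v x
+v-comm [] [] = refl
+v-comm (a ∷ x) (b ∷ y) = cong₂ _∷_ (xor-comm a b) (+v-comm x y)

+v-identityˡ : (x : 𝔽₂^ n) → 0v +v x ≡ x
+v-identityˡ = zipWith-identityˡ xor-identityˡ

+v-identityʳ : (x : 𝔽₂^ n) → x +v 0v ≡ x
+v-identityʳ = zipWith-identityʳ xor-identityʳ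

+v-self : (x : 𝔽₂^ n) → x +v x ≡ 0v
+v-self [] = refl
+v-self (a ∷ x) = cong₂ _∷_ (xor-same a) (+v-self x)

x+y+y≡x : (x y : 𝔽₂^ n) → (x +v y) +v y ≡ x
x+y+y≡x x y = begin
  (x +v y) +v y   ≡⟨ +v-assoc x y y ⟩
  x +v (y +v y)   ≡⟨ cong (x +v_) (+v-self y) ⟩
  x +v 0v         ≡⟨ +v-identityʳ x ⟩
  x               ∎
  where open ≡-Reasoning

+v≡0v⇒≡ : (x y : 𝔽₂^ n) → x +v y ≡ 0v → x ≡ y
+v≡0v⇒≡ x y eq = begin
  x               ≡⟨ sym (x+y+y≡x x y) ⟩
  (x +v y) +v y   ≡⟨ cong (_+v y) eq ⟩
  0v +v y         ≡⟨ +v-identityˡ y ⟩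
  y               ∎
  where open ≡-Reasoning

+v-interchange : (p q r s : 𝔽₂^ n) → (p +v q) +v (r +v s) ≡ (p +v r) +v (q +v s)
+v-interchange p q r s = begin
  (p +v q) +v (r +v s)   ≡⟨ +v-assoc p q (r +v s) ⟩
  p +v (q +v (r +v s))   ≡⟨ cong (p +v_) (sym (+v-assoc q r s)) ⟩
  p +v ((q +v r) +v s)   ≡⟨ cong (λ t → p +v (t +v s)) (+v-comm q r) ⟩
  p +v ((r +v q) +v s)   ≡⟨ cong (p +v_) (+v-assoc r q s) ⟩
  p +v (r +v (q +v s))   ≡⟨ sym (+v-assoc p r (q +v s)) ⟩
  (p +v r) +v (q +v s)   ∎
  where open ≡-Reasoning

_≟v_ : (x y : 𝔽₂^ n) → Dec (x ≡ y)
_≟v_ = ≡-dec _≟B_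

Additive : (𝔽₂^ n → 𝔽₂^ m) → Set
Additive f = ∀ x y → f (x +v y) ≡ f x +v f y

additive⇒0v↦0v : (f : 𝔽₂^ n → 𝔽₂^ m) → Additive f → f 0v ≡ 0v
additive⇒0v↦0v f f+ = begin
  f 0v              ≡⟨ cong f (sym (+v-self 0v)) ⟩
  f (0v +v 0v)      ≡⟨ f+ 0v 0v ⟩
  f 0v +v f 0v      ≡⟨ +v-self (f 0v) ⟩
  0v                ∎
  where open ≡-Reasoning

additive-if : (f : 𝔽₂^ n → 𝔽₂^ m) → Additive f →
              ∀ c x → f (if c then x else 0v) ≡ (if c then f x else 0v)
additive-if f f+ true  x = refl
additive-if f f+ false x = additive⇒0v↦0v f f+

Independent : Vec (𝔽₂^ n) k → Set
Independent b = ∀ c → lincomb c b ≡ 0v → c ≡ 0v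

lincomb-zero : (b : Vec (𝔽₂^ n) k) → lincomb 0v b ≡ 0v
lincomb-zero [] = refl
lincomb-zero (x ∷ b) = trans (+v-identityˡ _) (lincomb-zero b)

if-xor : ∀ a a′ (x : 𝔽₂^ n) →
         (if a xor a′ then x else 0v) ≡ (if a then x else 0v) +v (if a′ then x else 0v)
if-xor true  true  x = sym (+v-self x)
if-xor true  false x = sym (+v-identityʳ x)
if-xor false true  x = sym (+v-identityˡ x)
if-xor false false x = sym (+v-self 0v)

lincomb-+ : (b : Vec (𝔽₂^ n) k) → Additive (λ c → lincomb c b)
lincomb-+ [] [] [] = sym (+v-self 0v)
lincomb-+ (x ∷ b) (a ∷ c) (a′ ∷ c′) =
  trans (cong₂ _+v_ (if-xor a a′ x) (lincomb-+ b c c′)) (+v-interchange _ _ _ _)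

lincomb-++ : ∀ {k₁ k₂} (c₁ : Vec Bool k₁) (c₂ : Vec Bool k₂)
             (b₁ : Vec (𝔽₂^ n) k₁) (b₂ : Vec (𝔽₂^ n) k₂) →
             lincomb (c₁ ++ c₂) (b₁ ++ b₂) ≡ lincomb c₁ b₁ +v lincomb c₂ b₂
lincomb-++ [] c₂ [] b₂ = sym (+v-identityˡ _)
lincomb-++ (a ∷ c₁) c₂ (x ∷ b₁) b₂ =
  trans (cong (_ +v_) (lincomb-++ c₁ c₂ b₁ b₂)) (sym (+v-assoc _ _ _))

lincomb-map : (f : 𝔽₂^ n → 𝔽₂^ m) → Additive f →
              (c : Vec Bool k) (b : Vec (𝔽₂^ n) k) → lincomb c (map f b) ≡ f (lincomb c b)
lincomb-map f f+ [] [] = sym (additive⇒0v↦0v f f+)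
lincomb-map f f+ (a ∷ c) (x ∷ b) =
  trans (cong₂ _+v_ (sym (additive-if f f+ a x)) (lincomb-map f f+ c b)) (sym (f+ _ _))

lincomb-unit : (x : 𝔽₂^ n) (b : Vec (𝔽₂^ n) k) → lincomb (true ∷ 0v) (x ∷ b) ≡ x
lincomb-unit x b = trans (cong (x +v_) (lincomb-zero b)) (+v-identityʳ x)

Independent-tail : {x : 𝔽₂^ n} {b : Vec (𝔽₂^ n) k} → Independent (x ∷ b) → Independent b
Independent-tail ind c eq = ∷-injectiveʳ (ind (false ∷ c) (trans (+v-identityˡ _) eq))

_∈span_ : 𝔽₂^ n → Vec (𝔽₂^ n) k → Set
x ∈span b = ∃ λ c → lincomb c b ≡ x

∃-Vec-Bool? : ∀ l {P : Pred (Vec Bool l) 0ℓ} → (∀ c → Dec (P c)) → Dec (∃ P)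
∃-Vec-Bool? zero    P? = map′ ([] ,_) (λ { ([] , p) → p }) (P? [])
∃-Vec-Bool? (suc l) P? =
  map′ [ (λ { (c , p) → true ∷ c , p }) , (λ { (c , p) → false ∷ c , p }) ]
       (λ { (true ∷ c , p) → inj₁ (c , p) ; (false ∷ c , p) → inj₂ (c , p) })
       (∃-Vec-Bool? l (P? ∘ (true ∷_)) ⊎-dec ∃-Vec-Bool? l (P? ∘ (false ∷_)))

_∈span?_ : (x : 𝔽₂^ n) (b : Vec (𝔽₂^ n) k) → Dec (x ∈span b)
x ∈span? b = ∃-Vec-Bool? _ (λ c → lincomb c b ≟v x)

module _ {b : Vec (𝔽₂^ n) k} where

  0v∈span : 0v ∈span b
  0v∈span = 0v , lincomb-zero b

  ∈span-+ : {x y : 𝔽₂^ n} → x ∈span b → y ∈span b → (x +v y) ∈span b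
  ∈span-+ (c , refl) (c′ , refl) = c +v c′ , lincomb-+ b c c′

  ∈span-∷ : {x v : 𝔽₂^ n} → x ∈span b → x ∈span (v ∷ b)
  ∈span-∷ (c , eq) = false ∷ c , trans (+v-identityˡ _) eq

  lincomb∈span : {u : Vec (𝔽₂^ n) m} → VecAll.All (_∈span b) u → ∀ c → lincomb c u ∈span b
  lincomb∈span []         []          = 0v∈span
  lincomb∈span (x∈ ∷ u∈) (true  ∷ c) = ∈span-+ x∈ (lincomb∈span u∈ c)
  lincomb∈span (x∈ ∷ u∈) (false ∷ c) = ∈span-+ 0v∈span (lincomb∈span u∈ c)

  ∈span-trans : {u : Vec (𝔽₂^ n) m} → VecAll.All (_∈span b) u →
                {x : 𝔽₂^ n} → x ∈span u → x ∈span b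
  ∈span-trans u∈ (c , refl) = lincomb∈span u∈ c

additive-∈span : (f : 𝔽₂^ n → 𝔽₂^ m) → Additive f → {u : Vec (𝔽₂^ n) k} {b : Vec (𝔽₂^ m) d} →
                 VecAll.All (λ a → f a ∈span b) u → {x : 𝔽₂^ n} → x ∈span u → f x ∈span b
additive-∈span f f+ {u} u↦ (c , refl) =
  subst (_∈span _) (lincomb-map f f+ c u) (lincomb∈span (map⁺ u↦) c)

∈span-self : (b : Vec (𝔽₂^ n) k) → VecAll.All (_∈span b) b
∈span-self []      = []
∈span-self (x ∷ b) = (true ∷ 0v , lincomb-unit x b) ∷ VecAll.map ∈span-∷ (∈span-self b)

Independent-head∉span : {x : 𝔽₂^ n} {b : Vec (𝔽₂^ n) k} → Independent (x ∷ b) → ¬ x ∈span b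
Independent-head∉span {x = x} ind (c , eq) with ind (true ∷ c) (trans (cong (x +v_) eq) (+v-self x))
... | ()

Independent-head≢0v : {x : 𝔽₂^ n} {b : Vec (𝔽₂^ n) k} → Independent (x ∷ b) → x ≢ 0v
Independent-head≢0v ind refl = Independent-head∉span ind 0v∈span

Independent-∷ : {x : 𝔽₂^ n} {b : Vec (𝔽₂^ n) k} → Independent b → ¬ x ∈span b →
                Independent (x ∷ b)
Independent-∷ ind x∉ (true  ∷ c) eq = ⊥-elim (x∉ (c , sym (+v≡0v⇒≡ _ _ eq)))
Independent-∷ ind x∉ (false ∷ c) eq = cong (false ∷_) (ind c (trans (sym (+v-identityˡ _)) eq))

V-mono : {F G : VSet n} → F ⊆ G → V F ⊆ V G
V-mono F⊆G (inj₁ x≡0) = inj₁ x≡0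
V-mono F⊆G (inj₂ fx)  = inj₂ (F⊆G fx)

V⁺ : (F : VSet n) (x : 𝔽₂^ n) → (x ≢ 0v → F x) → V F x
V⁺ F x nz⇒F with x ≟v 0v
... | yes x≡0 = inj₁ x≡0
... | no  x≢0 = inj₂ (nz⇒F x≢0)

V∧≢0v⇒∈ : {F : VSet n} {x : 𝔽₂^ n} → V F x → x ≢ 0v → F x
V∧≢0v⇒∈ (inj₁ x≡0) x≢0 = ⊥-elim (x≢0 x≡0)
V∧≢0v⇒∈ (inj₂ fx)  x≢0 = fx

flat-nonzero : {F : VSet n} {x : 𝔽₂^ n} → IsFlat F → F x → x ≢ 0v
flat-nonzero (0∉F , _) fx refl = 0∉F fx

Span : Vec (𝔽₂^ n) k → VSet n
Span b x = x ∈span b × x ≢ 0v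

module _ (b : Vec (𝔽₂^ n) k) where

  V-Span⁻ : ∀ {x} → V (Span b) x → x ∈span b
  V-Span⁻ (inj₁ refl)     = 0v∈span
  V-Span⁻ (inj₂ (sp , _)) = sp

  V-Span⁺ : ∀ c → V (Span b) (lincomb c b)
  V-Span⁺ c = V⁺ (Span b) (lincomb c b) (λ nz → (c , refl) , nz)

  Span-isFlat : IsFlat (Span b)
  Span-isFlat = (λ { (_ , nz) → nz refl }) , closed
    where
    closed : ∀ x y → V (Span b) x → V (Span b) y → V (Span b) (x +v y)
    closed x y vx vy = V⁺ (Span b) (x +v y) (λ nz → ∈span-+ (V-Span⁻ vx) (V-Span⁻ vy) , nz)

  Span-hasDim : Independent b → HasDim (Span b) k
  Span-hasDim ind = b , ind , (λ x → V-Span⁻) , V-Span⁺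

SumOf : VSet n → VSet n
SumOf X x = ∃ λ xs → All X xs × sumList xs ≡ x

sumList-++ : (xs ys : List (𝔽₂^ n)) → sumList (xs List.++ ys) ≡ sumList xs +v sumList ys
sumList-++ []       ys = sym (+v-identityˡ _)
sumList-++ (x ∷ xs) ys = trans (cong (x +v_) (sumList-++ xs ys)) (sym (+v-assoc _ _ _))

module _ {X : VSet n} where

  V-cl⁻ : ∀ {x} → V (cl X) x → SumOf X x
  V-cl⁻ (inj₁ refl)      = [] , [] , refl
  V-cl⁻ (inj₂ (sum , _)) = sum

  cl-isFlat : IsFlat (cl X)
  cl-isFlat = (λ { (_ , nz) → nz refl }) , closed
    where
    closed : ∀ x y → V (cl X) x → V (cl X) y → V (cl X) (x +v y)
    closed x y vx vy with V-cl⁻ vx | V-cl⁻ vy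
    ... | xs , allx , refl | ys , ally , refl =
      V⁺ (cl X) _ (λ nz → (xs List.++ ys , ++⁺ allx ally , sumList-++ xs ys) , nz)

  V⊆V-cl : V X ⊆ V (cl X)
  V⊆V-cl (inj₁ x≡0) = inj₁ x≡0
  V⊆V-cl {x} (inj₂ px) = V⁺ (cl X) x (λ nz → (x ∷ [] , px ∷ [] , +v-identityʳ x) , nz)

  cl-least : {F : VSet n} → IsFlat F → X ⊆ F → cl X ⊆ F
  cl-least {F} (_ , closed) X⊆F ((xs , allx , refl) , nz) = V∧≢0v⇒∈ {F = F} (sum∈V xs allx) nz
    where
    sum∈V : ∀ xs → All X xs → V F (sumList xs)
    sum∈V []       []           = inj₁ refl
    sum∈V (x ∷ xs) (px ∷ allx) = closed x (sumList xs) (inj₂ (X⊆F px)) (sum∈V xs allx)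

-- Direct sums

fst-++ : (a : 𝔽₂^ m) (b : 𝔽₂^ n) → fst {m} {n} (a ++ b) ≡ a
fst-++ []      b = refl
fst-++ (x ∷ a) b = cong (x ∷_) (fst-++ a b)

snd-++ : (a : 𝔽₂^ m) (b : 𝔽₂^ n) → snd {m} {n} (a ++ b) ≡ b
snd-++ []      b = refl
snd-++ (x ∷ a) b = snd-++ a b

0v-++ : 0v {m + n} ≡ 0v {m} ++ 0v {n}
0v-++ {zero}  = refl
0v-++ {suc m} = cong (false ∷_) (0v-++ {m})

module DirectSum (m n : ℕ) where

  π₁ : 𝔽₂^ (m + n) → 𝔽₂^ m
  π₁ = fst {m} {n}

  π₂ : 𝔽₂^ (m + n) → 𝔽₂^ n
  π₂ = snd {m} {n}

  embed₁ : 𝔽₂^ m → 𝔽₂^ (m + n)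
  embed₁ a = a ++ 0v

  embed₂ : 𝔽₂^ n → 𝔽₂^ (m + n)
  embed₂ b = 0v ++ b

  π₁-+ : Additive π₁
  π₁-+ = take-zipWith _xor_

  π₂-+ : Additive π₂
  π₂-+ = drop-zipWith _xor_

  π₁-0v : π₁ 0v ≡ 0v
  π₁-0v = additive⇒0v↦0v π₁ π₁-+

  π₂-0v : π₂ 0v ≡ 0v
  π₂-0v = additive⇒0v↦0v π₂ π₂-+

  π₁-++ : (a : 𝔽₂^ m) (b : 𝔽₂^ n) → π₁ (a ++ b) ≡ a
  π₁-++ = fst-++

  π₂-++ : (a : 𝔽₂^ m) (b : 𝔽₂^ n) → π₂ (a ++ b) ≡ b
  π₂-++ = snd-++

  π₁++π₂ : (v : 𝔽₂^ (m + n)) → π₁ v ++ π₂ v ≡ v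
  π₁++π₂ = take++drop≡id m

  π≡0v⇒≡0v : (v : 𝔽₂^ (m + n)) → π₁ v ≡ 0v → π₂ v ≡ 0v → v ≡ 0v
  π≡0v⇒≡0v v p q = begin
    v             ≡⟨ sym (π₁++π₂ v) ⟩
    π₁ v ++ π₂ v  ≡⟨ cong₂ _++_ p q ⟩
    0v {m} ++ 0v  ≡⟨ sym (0v-++ {m}) ⟩
    0v            ∎
    where open ≡-Reasoning

  π₁≢0v⇒≢0v : {v : 𝔽₂^ (m + n)} → π₁ v ≢ 0v → v ≢ 0v
  π₁≢0v⇒≢0v π₁v≢0 refl = π₁v≢0 π₁-0v

  π₂≢0v⇒≢0v : {v : 𝔽₂^ (m + n)} → π₂ v ≢ 0v → v ≢ 0v
  π₂≢0v⇒≢0v π₂v≢0 refl = π₂v≢0 π₂-0v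

  ++-+v : (a : 𝔽₂^ m) (b : 𝔽₂^ n) (c : 𝔽₂^ m) (d : 𝔽₂^ n) →
          (a ++ b) +v (c ++ d) ≡ (a +v c) ++ (b +v d)
  ++-+v = zipWith-++ _xor_

  embed₁-+ : Additive embed₁
  embed₁-+ a a′ = begin
    (a +v a′) ++ 0v            ≡⟨ cong ((a +v a′) ++_) (sym (+v-self 0v)) ⟩
    (a +v a′) ++ (0v +v 0v)    ≡⟨ sym (++-+v a 0v a′ 0v) ⟩
    embed₁ a +v embed₁ a′      ∎
    where open ≡-Reasoning

  embed₂-+ : Additive embed₂
  embed₂-+ b b′ = begin
    0v ++ (b +v b′)            ≡⟨ cong (_++ (b +v b′)) (sym (+v-self 0v)) ⟩
    (0v +v 0v) ++ (b +v b′)    ≡⟨ sym (++-+v 0v b 0v b′) ⟩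
    embed₂ b +v embed₂ b′      ∎
    where open ≡-Reasoning

  embed₁+embed₂ : (a : 𝔽₂^ m) (b : 𝔽₂^ n) → embed₁ a +v embed₂ b ≡ a ++ b
  embed₁+embed₂ a b = trans (++-+v a 0v 0v b) (cong₂ _++_ (+v-identityʳ a) (+v-identityˡ b))

  embed₁π₁+embed₂π₂ : (v : 𝔽₂^ (m + n)) → embed₁ (π₁ v) +v embed₂ (π₂ v) ≡ v
  embed₁π₁+embed₂π₂ v = trans (embed₁+embed₂ (π₁ v) (π₂ v)) (π₁++π₂ v)

  π₂≡0v⇒embed₁π₁ : (v : 𝔽₂^ (m + n)) → π₂ v ≡ 0v → embed₁ (π₁ v) ≡ v
  π₂≡0v⇒embed₁π₁ v π₂v≡0 = trans (cong (π₁ v ++_) (sym π₂v≡0)) (π₁++π₂ v)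

  ι₂+Sι₁⁻ : {P : VSet n} {Q : VSet m} {v : 𝔽₂^ (m + n)} →
            (ι₂ {m} {n} P +S ι₁ {m} {n} Q) v → P (π₂ v) × Q (π₁ v)
  ι₂+Sι₁⁻ {P} {Q} (x , y , (π₁x≡0 , px) , (π₂y≡0 , qy) , refl) =
    subst P (sym π₂-sum) px , subst Q (sym π₁-sum) qy
    where
    π₂-sum : π₂ (x +v y) ≡ π₂ x
    π₂-sum = trans (π₂-+ x y) (trans (cong (π₂ x +v_) π₂y≡0) (+v-identityʳ _))
    π₁-sum : π₁ (x +v y) ≡ π₁ y
    π₁-sum = trans (π₁-+ x y) (trans (cong (_+v π₁ y) π₁x≡0) (+v-identityˡ _))

  ι₂+Sι₁⁺ : {P : VSet n} {Q : VSet m} {v : 𝔽₂^ (m + n)} →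
            P (π₂ v) → Q (π₁ v) → (ι₂ {m} {n} P +S ι₁ {m} {n} Q) v
  ι₂+Sι₁⁺ {P} {Q} {v} p q =
    embed₂ (π₂ v) , embed₁ (π₁ v) ,
    (π₁-++ 0v (π₂ v) , subst P (sym (π₂-++ 0v (π₂ v))) p) ,
    (π₂-++ (π₁ v) 0v , subst Q (sym (π₁-++ (π₁ v) 0v)) q) ,
    sym (trans (+v-comm _ _) (embed₁π₁+embed₂π₂ v))

  V-⊕G⁻ : {A : VSet m} {C : VSet n} {v : 𝔽₂^ (m + n)} →
          V (_⊕G_ {m} {n} A C) v → V A (π₁ v) × V C (π₂ v)
  V-⊕G⁻ (inj₁ refl)          = inj₁ π₁-0v , inj₁ π₂-0v
  V-⊕G⁻ (inj₂ (va , vc , _)) = va , vc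

  V-⊕G⁺ : {A : VSet m} {C : VSet n} {v : 𝔽₂^ (m + n)} →
          V A (π₁ v) → V C (π₂ v) → V (_⊕G_ {m} {n} A C) v
  V-⊕G⁺ {A} {C} {v} va vc = V⁺ (_⊕G_ {m} {n} A C) v (λ nz → va , vc , nz)

  ⊕G-isFlat : {A : VSet m} {C : VSet n} → IsFlat A → IsFlat C → IsFlat (_⊕G_ {m} {n} A C)
  ⊕G-isFlat {A} {C} (_ , closedA) (_ , closedC) = (λ { (_ , _ , nz) → nz refl }) , closed
    where
    closed : ∀ x y → V (_⊕G_ {m} {n} A C) x → V (_⊕G_ {m} {n} A C) y →
             V (_⊕G_ {m} {n} A C) (x +v y)
    closed x y vx vy with V-⊕G⁻ {A = A} {C} vx | V-⊕G⁻ {A = A} {C} vy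
    ... | ax , cx | ay , cy =
      V-⊕G⁺ {A = A} {C} (subst (V A) (sym (π₁-+ x y)) (closedA _ _ ax ay))
            (subst (V C) (sym (π₂-+ x y)) (closedC _ _ cx cy))

  V-ι₁ : {X : VSet m} {a : 𝔽₂^ m} → V X a → V (ι₁ {m} {n} X) (embed₁ a)
  V-ι₁ {X} {a} va = V⁺ (ι₁ {m} {n} X) (embed₁ a) λ nz →
    π₂-++ a 0v ,
    subst X (sym (π₁-++ a 0v))
      (V∧≢0v⇒∈ {F = X} va (λ a≡0 → nz (trans (cong embed₁ a≡0) (additive⇒0v↦0v embed₁ embed₁-+))))

  V-ι₂ : {X : VSet n} {b : 𝔽₂^ n} → V X b → V (ι₂ {m} {n} X) (embed₂ b)
  V-ι₂ {X} {b} vb = V⁺ (ι₂ {m} {n} X) (embed₂ b) λ nz →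
    π₁-++ 0v b ,
    subst X (sym (π₂-++ 0v b))
      (V∧≢0v⇒∈ {F = X} vb (λ b≡0 → nz (trans (cong embed₂ b≡0) (additive⇒0v↦0v embed₂ embed₂-+))))

  cl-ι₁∪ι₂ : {F₁ : VSet m} {F₂ : VSet n} → IsFlat F₁ → IsFlat F₂ →
             cl (ι₁ {m} {n} F₁ ∪ ι₂ {m} {n} F₂) ≐ (_⊕G_ {m} {n} F₁ F₂)
  cl-ι₁∪ι₂ {F₁} {F₂} fl₁ fl₂ = cl-least (⊕G-isFlat fl₁ fl₂) ι∪⊆⊕G , ⊕G⊆cl
    where
    X = ι₁ {m} {n} F₁ ∪ ι₂ {m} {n} F₂
    ι∪⊆⊕G : X ⊆ _⊕G_ {m} {n} F₁ F₂
    ι∪⊆⊕G (inj₁ (π₂x≡0 , f₁)) = inj₂ f₁ , inj₁ π₂x≡0 , π₁≢0v⇒≢0v (flat-nonzero fl₁ f₁)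
    ι∪⊆⊕G (inj₂ (π₁x≡0 , f₂)) = inj₁ π₁x≡0 , inj₂ f₂ , π₂≢0v⇒≢0v (flat-nonzero fl₂ f₂)
    ⊕G⊆cl : _⊕G_ {m} {n} F₁ F₂ ⊆ cl X
    ⊕G⊆cl {v} (va , vb , nz) = V∧≢0v⇒∈ {F = cl X} (subst (V (cl X)) (embed₁π₁+embed₂π₂ v) v-sum∈V) nz
      where
      v-sum∈V : V (cl X) (embed₁ (π₁ v) +v embed₂ (π₂ v))
      v-sum∈V = proj₂ cl-isFlat _ _
        (V⊆V-cl (V-mono {G = X} inj₁ (V-ι₁ {X = F₁} va)))
        (V⊆V-cl (V-mono {G = X} inj₂ (V-ι₂ {X = F₂} vb)))

  ⊕G-hasDim : {A : VSet m} {C : VSet n} {k₁ k₂ : ℕ} →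
              HasDim A k₁ → HasDim C k₂ → HasDim (_⊕G_ {m} {n} A C) (k₁ + k₂)
  ⊕G-hasDim {A} {C} {k₁} {k₂} (b₁ , ind₁ , span₁ , in₁) (b₂ , ind₂ , span₂ , in₂) =
    B , indB , spanB , inB
    where
    B = map embed₁ b₁ ++ map embed₂ b₂

    lincomb-B : ∀ c₁ c₂ → lincomb (c₁ ++ c₂) B ≡ lincomb c₁ b₁ ++ lincomb c₂ b₂
    lincomb-B c₁ c₂ = begin
      lincomb (c₁ ++ c₂) B
        ≡⟨ lincomb-++ c₁ c₂ _ _ ⟩
      lincomb c₁ (map embed₁ b₁) +v lincomb c₂ (map embed₂ b₂)
        ≡⟨ cong₂ _+v_ (lincomb-map embed₁ embed₁-+ c₁ b₁) (lincomb-map embed₂ embed₂-+ c₂ b₂) ⟩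
      embed₁ (lincomb c₁ b₁) +v embed₂ (lincomb c₂ b₂)
        ≡⟨ embed₁+embed₂ _ _ ⟩
      lincomb c₁ b₁ ++ lincomb c₂ b₂
        ∎
      where open ≡-Reasoning

    lincomb-B′ : ∀ c → lincomb c B ≡ lincomb (take k₁ c) b₁ ++ lincomb (drop k₁ c) b₂
    lincomb-B′ c = trans (cong (λ c′ → lincomb c′ B) (sym (take++drop≡id k₁ c)))
                         (lincomb-B (take k₁ c) (drop k₁ c))

    indB : Independent B
    indB c eq = begin
      c                       ≡⟨ sym (take++drop≡id k₁ c) ⟩
      take k₁ c ++ drop k₁ c  ≡⟨ cong₂ _++_ (ind₁ (take k₁ c) (++-injectiveˡ L₁ 0v parts≡0))
                                            (ind₂ (drop k₁ c) (++-injectiveʳ L₁ 0v parts≡0)) ⟩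
      0v {k₁} ++ 0v           ≡⟨ sym (0v-++ {k₁} {k₂}) ⟩
      0v                      ∎
      where
      open ≡-Reasoning
      L₁ = lincomb (take k₁ c) b₁
      parts≡0 : L₁ ++ lincomb (drop k₁ c) b₂ ≡ 0v {m} ++ 0v
      parts≡0 = trans (sym (lincomb-B′ c)) (trans eq (0v-++ {m} {n}))

    spanB : ∀ v → V (_⊕G_ {m} {n} A C) v → ∃ λ c → lincomb c B ≡ v
    spanB v vv with V-⊕G⁻ {A = A} {C} vv
    ... | va , vc with span₁ _ va | span₂ _ vc
    ... | c₁ , e₁ | c₂ , e₂ = c₁ ++ c₂ , trans (lincomb-B c₁ c₂) (trans (cong₂ _++_ e₁ e₂) (π₁++π₂ v))

    inB : ∀ c → V (_⊕G_ {m} {n} A C) (lincomb c B)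
    inB c = V-⊕G⁺ {A = A} {C}
      (subst (V A) (sym (trans (cong π₁ (lincomb-B′ c)) (π₁-++ L₁ L₂))) (in₁ (take k₁ c)))
      (subst (V C) (sym (trans (cong π₂ (lincomb-B′ c)) (π₂-++ L₁ L₂))) (in₂ (drop k₁ c)))
      where
      L₁ = lincomb (take k₁ c) b₁
      L₂ = lincomb (drop k₁ c) b₂

-- Dimension

-- Rank–nullity for π₂ restricted to span b.
module _ {m n : ℕ} where
  open DirectSum m n

  record ProjectionSplit {j : ℕ} (b : Vec (𝔽₂^ (m + n)) j) : Set where
    field
      kernelDim imageDim : ℕ
      kernelBasis        : Vec (𝔽₂^ m) kernelDim
      imageBasis         : Vec (𝔽₂^ n) imageDim
      kernel-independent : Independent kernelBasis
      image-independent  : Independent imageBasis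
      length-split       : j ≡ kernelDim + imageDim
      kernel⊆span        : VecAll.All (λ a → embed₁ a ∈span b) kernelBasis
      image⊆span         : VecAll.All (_∈span map π₂ b) imageBasis

  module _ {j} {v : 𝔽₂^ (m + n)} {b : Vec (𝔽₂^ (m + n)) j} (S : ProjectionSplit b) where
    open ProjectionSplit S

    extendImage : ¬ π₂ v ∈span imageBasis → ProjectionSplit (v ∷ b)
    extendImage π₂v∉ = record
      { kernelDim = kernelDim ; imageDim = suc imageDim
      ; kernelBasis = kernelBasis ; imageBasis = π₂ v ∷ imageBasis
      ; kernel-independent = kernel-independent
      ; image-independent = Independent-∷ image-independent π₂v∉
      ; length-split = trans (cong suc length-split) (sym (+-suc kernelDim imageDim))
      ; kernel⊆span = VecAll.map ∈span-∷ kernel⊆span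
      ; image⊆span = (true ∷ 0v , lincomb-unit (π₂ v) (map π₂ b)) ∷ VecAll.map ∈span-∷ image⊆span
      }

    extendKernel : Independent (v ∷ b) → π₂ v ∈span imageBasis → ProjectionSplit (v ∷ b)
    extendKernel ind π₂v∈ = record
      { kernelDim = suc kernelDim ; imageDim = imageDim
      ; kernelBasis = π₁ z ∷ kernelBasis ; imageBasis = imageBasis
      ; kernel-independent = Independent-∷ kernel-independent π₁z∉span
      ; image-independent = image-independent
      ; length-split = cong suc length-split
      ; kernel⊆span = (true ∷ ds , sym embed₁π₁z≡z) ∷ VecAll.map ∈span-∷ kernel⊆span
      ; image⊆span = VecAll.map ∈span-∷ image⊆span
      }
      where
      π₂v∈π₂span : π₂ v ∈span map π₂ b
      π₂v∈π₂span = ∈span-trans image⊆span π₂v∈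

      ds = proj₁ π₂v∈π₂span
      z = v +v lincomb ds b

      π₂z≡0 : π₂ z ≡ 0v
      π₂z≡0 = begin
        π₂ (v +v lincomb ds b)          ≡⟨ π₂-+ v _ ⟩
        π₂ v +v π₂ (lincomb ds b)       ≡⟨ cong (π₂ v +v_) (sym (lincomb-map π₂ π₂-+ ds b)) ⟩
        π₂ v +v lincomb ds (map π₂ b)   ≡⟨ cong (π₂ v +v_) (proj₂ π₂v∈π₂span) ⟩
        π₂ v +v π₂ v                    ≡⟨ +v-self (π₂ v) ⟩
        0v                              ∎
        where open ≡-Reasoning

      embed₁π₁z≡z : embed₁ (π₁ z) ≡ z
      embed₁π₁z≡z = π₂≡0v⇒embed₁π₁ z π₂z≡0

      π₁z∉span : ¬ π₁ z ∈span kernelBasis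
      π₁z∉span (c , c↦π₁z) = Independent-head∉span ind (subst (_∈span b) (x+y+y≡x v _) v∈span)
        where
        z∈span : z ∈span b
        z∈span = subst (_∈span b) embed₁π₁z≡z (additive-∈span embed₁ embed₁-+ kernel⊆span (c , c↦π₁z))
        v∈span : (z +v lincomb ds b) ∈span b
        v∈span = ∈span-+ z∈span (ds , refl)

  projectionSplit : ∀ {j} (b : Vec (𝔽₂^ (m + n)) j) → Independent b → ProjectionSplit b
  projectionSplit [] _ = record
    { kernelDim = 0 ; imageDim = 0
    ; kernelBasis = [] ; imageBasis = []
    ; kernel-independent = λ { [] _ → refl } ; image-independent = λ { [] _ → refl }
    ; length-split = refl ; kernel⊆span = [] ; image⊆span = []
    }
  projectionSplit (v ∷ b) ind = extend (projectionSplit b (Independent-tail ind))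
    where
    extend : ProjectionSplit b → ProjectionSplit (v ∷ b)
    extend S with π₂ v ∈span? ProjectionSplit.imageBasis S
    ... | yes π₂v∈ = extendKernel S ind π₂v∈
    ... | no  π₂v∉ = extendImage S π₂v∉

𝔽₂¹-nonzero : (x : 𝔽₂^ 1) → x ≢ 0v → x ≡ true ∷ []
𝔽₂¹-nonzero (true  ∷ []) _   = refl
𝔽₂¹-nonzero (false ∷ []) x≢0 = ⊥-elim (x≢0 refl)

Independent⇒length≤1 : {b : Vec (𝔽₂^ 1) k} → Independent b → k ≤ 1
Independent⇒length≤1 {b = []}         _   = z≤n
Independent⇒length≤1 {b = _ ∷ []}     _   = s≤s z≤n
Independent⇒length≤1 {b = x ∷ y ∷ b} ind =
  ⊥-elim (Independent-head∉span ind (true ∷ 0v , trans (lincomb-unit y b) y≡x))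
  where
  y≡x : y ≡ x
  y≡x = trans (𝔽₂¹-nonzero y (Independent-head≢0v (Independent-tail ind)))
              (sym (𝔽₂¹-nonzero x (Independent-head≢0v ind)))

Independent⇒length≤dim : {b : Vec (𝔽₂^ n) k} → Independent b → k ≤ n
Independent⇒length≤dim {zero}  {b = []}     _   = z≤n
Independent⇒length≤dim {zero}  {b = [] ∷ _} ind = ⊥-elim (Independent-head≢0v ind refl)
Independent⇒length≤dim {suc n} {b = b}      ind =
  subst (_≤ suc n) (sym length-split)
    (+-mono-≤ (Independent⇒length≤1 kernel-independent) (Independent⇒length≤dim image-independent))
  where open ProjectionSplit (projectionSplit {1} {n} b ind)

coordinates : {u : Vec (𝔽₂^ n) k} {b : Vec (𝔽₂^ n) d} → VecAll.All (_∈span b) u →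
              Σ (Vec (𝔽₂^ d) k) λ cs → map (λ c → lincomb c b) cs ≡ u
coordinates []                = [] , refl
coordinates ((c , refl) ∷ u∈) with coordinates u∈
... | cs , refl = c ∷ cs , refl

Independent⇒length≤spanning : {u : Vec (𝔽₂^ n) k} {b : Vec (𝔽₂^ n) d} →
                              Independent u → VecAll.All (_∈span b) u → k ≤ d
Independent⇒length≤spanning {b = b} ind u∈ with coordinates u∈
... | cs , refl = Independent⇒length≤dim cs-independent
  where
  cs-independent : Independent cs
  cs-independent e e↦0 = ind e (begin
    lincomb e (map (λ c → lincomb c b) cs)  ≡⟨ lincomb-map (λ c → lincomb c b) (lincomb-+ b) e cs ⟩
    lincomb (lincomb e cs) b                ≡⟨ cong (λ c → lincomb c b) e↦0 ⟩
    lincomb 0v b                            ≡⟨ lincomb-zero b ⟩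
    0v                                      ∎)
    where open ≡-Reasoning

HasDim-mono : {F G : VSet n} → F ⊆ G → HasDim F k → HasDim G d → k ≤ d
HasDim-mono {F = F} F⊆G (u , u-independent , _ , u-in) (b , _ , b-spans , _) =
  Independent⇒length≤spanning u-independent (VecAll.map x∈span-b (∈span-self u))
  where
  x∈span-b : ∀ {x} → x ∈span u → x ∈span b
  x∈span-b {x} (c , c↦x) = b-spans x (V-mono {F = F} F⊆G (subst (V F) c↦x (u-in c)))

-- The lift-join

FlatOfDimIn : VSet n → ℕ → Set₁
FlatOfDimIn X k = Σ (VSet _) λ F → IsFlat F × F ⊆ X × HasDim F k

G-nonzero : {M : Matroid n} {x : 𝔽₂^ n} → IsMatroid M → G M x → x ≢ 0v
G-nonzero (flat , _) = flat-nonzero flat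

E-nonzero : {M : Matroid n} {x : 𝔽₂^ n} → IsMatroid M → E M x → x ≢ 0v
E-nonzero m@(_ , E⊆G) = G-nonzero m ∘ E⊆G

IsMatroid-ᶜ : {M : Matroid n} → IsMatroid M → IsMatroid (M ᶜ)
IsMatroid-ᶜ (flat , _) = flat , proj₁

IsOmega-resp-≐ : {M N : Matroid n} → E M ≐ E N → IsOmega M k → IsOmega N k
IsOmega-resp-≐ (M⊆N , N⊆M) ((F , flat , F⊆E , dim) , maximal) =
  (F , flat , M⊆N ∘ F⊆E , dim) ,
  λ F′ j flat′ F′⊆E dim′ → maximal F′ j flat′ (N⊆M ∘ F′⊆E) dim′

IsOmega-ᶜ≤IsDim : {M : Matroid n} → IsDim M d → IsOmega (M ᶜ) k → k ≤ d
IsOmega-ᶜ≤IsDim dim ((F , _ , F⊆Eᶜ , dimF) , _) = HasDim-mono (proj₁ ∘ F⊆Eᶜ) dimF dim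

module _ {n₁ n₂ : ℕ} (M₁ : Matroid n₁) (M₂ : Matroid n₂) where
  open DirectSum n₁ n₂

  E⊗⁻ : {v : 𝔽₂^ (n₁ + n₂)} → E (M₁ ⊗ M₂) v →
        (π₂ v ≡ 0v × E M₁ (π₁ v)) ⊎ (E M₂ (π₂ v) × V (G M₁) (π₁ v))
  E⊗⁻ (inj₁ e) = inj₁ e
  E⊗⁻ (inj₂ s) = inj₂ (ι₂+Sι₁⁻ {P = E M₂} {Q = V (G M₁)} s)

  E⊗⁺ : {v : 𝔽₂^ (n₁ + n₂)} →
        (π₂ v ≡ 0v × E M₁ (π₁ v)) ⊎ (E M₂ (π₂ v) × V (G M₁) (π₁ v)) → E (M₁ ⊗ M₂) v
  E⊗⁺ (inj₁ e)          = inj₁ e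
  E⊗⁺ (inj₂ (e₂ , vg₁)) = inj₂ (ι₂+Sι₁⁺ {P = E M₂} {Q = V (G M₁)} e₂ vg₁)

module _ {n₁ n₂ : ℕ} {M₁ : Matroid n₁} {M₂ : Matroid n₂} (m₁ : IsMatroid M₁) (m₂ : IsMatroid M₂) where
  open DirectSum n₁ n₂

  ⊗-ᶜ : ((M₁ ⊗ M₂) ᶜ) ≈M ((M₁ ᶜ) ⊗ (M₂ ᶜ))
  ⊗-ᶜ = (to , from) , (λ g → g) , (λ g → g)
    where
    to : E ((M₁ ⊗ M₂) ᶜ) ⊆ E ((M₁ ᶜ) ⊗ (M₂ ᶜ))
    to {v} ((va , vb , v≢0) , v∉E) with π₂ v ≟v 0v
    ... | yes π₂v≡0 = inj₁ (π₂v≡0 , g₁ , λ e₁ → v∉E (inj₁ (π₂v≡0 , e₁)))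
      where
      g₁ : G M₁ (π₁ v)
      g₁ = V∧≢0v⇒∈ {F = G M₁} va (λ π₁v≡0 → v≢0 (π≡0v⇒≡0v v π₁v≡0 π₂v≡0))
    ... | no  π₂v≢0 =
      E⊗⁺ (M₁ ᶜ) (M₂ ᶜ) (inj₂ ((g₂ , λ e₂ → v∉E (E⊗⁺ M₁ M₂ (inj₂ (e₂ , va)))) , va))
      where
      g₂ : G M₂ (π₂ v)
      g₂ = V∧≢0v⇒∈ {F = G M₂} vb π₂v≢0
    from : E ((M₁ ᶜ) ⊗ (M₂ ᶜ)) ⊆ E ((M₁ ⊗ M₂) ᶜ)
    from {v} e with E⊗⁻ (M₁ ᶜ) (M₂ ᶜ) e
    ... | inj₁ (π₂v≡0 , g₁ , ∉E₁) =
      (inj₂ g₁ , inj₁ π₂v≡0 , π₁≢0v⇒≢0v (G-nonzero m₁ g₁)) ,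
      [ ∉E₁ ∘ proj₂ , (λ (e₂ , _) → E-nonzero m₂ e₂ π₂v≡0) ] ∘ E⊗⁻ M₁ M₂
    ... | inj₂ ((g₂ , ∉E₂) , va) =
      (va , inj₂ g₂ , π₂≢0v⇒≢0v (G-nonzero m₂ g₂)) ,
      [ (λ (π₂v≡0 , _) → G-nonzero m₂ g₂ π₂v≡0) , ∉E₂ ∘ proj₁ ] ∘ E⊗⁻ M₁ M₂

  ⊗-∣cl : ∀ F₁ F₂ → IsFlatOf F₁ (G M₁) → IsFlatOf F₂ (G M₂) →
          ((M₁ ⊗ M₂) ∣ cl (ι₁ {n₁} {n₂} F₁ ∪ ι₂ {n₁} {n₂} F₂)) ≈M ((M₁ ∣ F₁) ⊗ (M₂ ∣ F₂))
  ⊗-∣cl F₁ F₂ (fl₁ , F₁⊆G₁) (fl₂ , _) = (to , from) , cl≐⊕G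
    where
    X = ι₁ {n₁} {n₂} F₁ ∪ ι₂ {n₁} {n₂} F₂
    cl≐⊕G : cl X ≐ _⊕G_ {n₁} {n₂} F₁ F₂
    cl≐⊕G = cl-ι₁∪ι₂ fl₁ fl₂
    to : E ((M₁ ⊗ M₂) ∣ cl X) ⊆ E ((M₁ ∣ F₁) ⊗ (M₂ ∣ F₂))
    to {v} (e , v∈cl) with proj₁ cl≐⊕G v∈cl | E⊗⁻ M₁ M₂ e
    ... | va , _ , v≢0 | inj₁ (π₂v≡0 , e₁) = E⊗⁺ (M₁ ∣ F₁) (M₂ ∣ F₂) (inj₁ (π₂v≡0 , e₁ , f₁))
      where
      f₁ : F₁ (π₁ v)
      f₁ = V∧≢0v⇒∈ {F = F₁} va (λ π₁v≡0 → v≢0 (π≡0v⇒≡0v v π₁v≡0 π₂v≡0))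
    ... | va , vb , _ | inj₂ (e₂ , _) =
      E⊗⁺ (M₁ ∣ F₁) (M₂ ∣ F₂) (inj₂ ((e₂ , V∧≢0v⇒∈ {F = F₂} vb (E-nonzero m₂ e₂)) , va))
    from : E ((M₁ ∣ F₁) ⊗ (M₂ ∣ F₂)) ⊆ E ((M₁ ⊗ M₂) ∣ cl X)
    from {v} e with E⊗⁻ (M₁ ∣ F₁) (M₂ ∣ F₂) e
    ... | inj₁ (π₂v≡0 , e₁ , f₁) =
      E⊗⁺ M₁ M₂ (inj₁ (π₂v≡0 , e₁)) ,
      proj₂ cl≐⊕G (inj₂ f₁ , inj₁ π₂v≡0 , π₁≢0v⇒≢0v (flat-nonzero fl₁ f₁))
    ... | inj₂ ((e₂ , f₂) , va) =
      E⊗⁺ M₁ M₂ (inj₂ (e₂ , V-mono {F = F₁} F₁⊆G₁ va)) ,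
      proj₂ cl≐⊕G (va , inj₂ f₂ , π₂≢0v⇒≢0v (flat-nonzero fl₂ f₂))

  ⊕G⊆E⊗ : {F₁ : VSet n₁} {F₂ : VSet n₂} → F₁ ⊆ E M₁ → F₂ ⊆ E M₂ →
          _⊕G_ {n₁} {n₂} F₁ F₂ ⊆ E (M₁ ⊗ M₂)
  ⊕G⊆E⊗ {F₁} F₁⊆E₁ F₂⊆E₂ {v} (va , inj₁ π₂v≡0 , v≢0) =
    E⊗⁺ M₁ M₂ (inj₁ (π₂v≡0 , F₁⊆E₁ f₁))
    where
    f₁ : F₁ (π₁ v)
    f₁ = V∧≢0v⇒∈ {F = F₁} va (λ π₁v≡0 → v≢0 (π≡0v⇒≡0v v π₁v≡0 π₂v≡0))
  ⊕G⊆E⊗ {F₁} F₁⊆E₁ F₂⊆E₂ (va , inj₂ f₂ , _) =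
    E⊗⁺ M₁ M₂ (inj₂ (F₂⊆E₂ f₂ , V-mono {F = F₁} (proj₂ m₁ ∘ F₁⊆E₁) va))

  FlatOfDimIn-⊗ : ∀ {w₁ w₂} → FlatOfDimIn (E M₁) w₁ → FlatOfDimIn (E M₂) w₂ →
                  FlatOfDimIn (E (M₁ ⊗ M₂)) (w₁ + w₂)
  FlatOfDimIn-⊗ (F₁ , fl₁ , F₁⊆E₁ , dim₁) (F₂ , fl₂ , F₂⊆E₂ , dim₂) =
    _⊕G_ {n₁} {n₂} F₁ F₂ , ⊕G-isFlat fl₁ fl₂ , ⊕G⊆E⊗ F₁⊆E₁ F₂⊆E₂ , ⊕G-hasDim dim₁ dim₂

  FlatOfDimIn-⊗-split : {F : VSet (n₁ + n₂)} {j : ℕ} → F ⊆ E (M₁ ⊗ M₂) → HasDim F j →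
                        ∃ λ k → ∃ λ l → j ≡ k + l × FlatOfDimIn (E M₁) k × FlatOfDimIn (E M₂) l
  FlatOfDimIn-⊗-split {F} F⊆E (b , independent , _ , b-in) =
    kernelDim , imageDim , length-split ,
    (Span kernelBasis , Span-isFlat kernelBasis , kernel⊆E₁ , Span-hasDim kernelBasis kernel-independent) ,
    (Span imageBasis , Span-isFlat imageBasis , image⊆E₂ , Span-hasDim imageBasis image-independent)
    where
    open ProjectionSplit (projectionSplit {n₁} {n₂} b independent)

    span⊆E : ∀ {x} → x ∈span b → x ≢ 0v → E (M₁ ⊗ M₂) x
    span⊆E (d , refl) x≢0 = F⊆E (V∧≢0v⇒∈ {F = F} (b-in d) x≢0)

    kernel⊆E₁ : Span kernelBasis ⊆ E M₁
    kernel⊆E₁ {a} (a∈ , a≢0) =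
      [ subst (E M₁) (π₁-++ a 0v) ∘ proj₂ , (λ (e₂ , _) → ⊥-elim (E-nonzero m₂ e₂ (π₂-++ a 0v))) ]
        (E⊗⁻ M₁ M₂ embed₁a∈E)
      where
      embed₁a∈E : E (M₁ ⊗ M₂) (embed₁ a)
      embed₁a∈E = span⊆E (additive-∈span embed₁ embed₁-+ kernel⊆span a∈)
                         (π₁≢0v⇒≢0v (a≢0 ∘ trans (sym (π₁-++ a 0v))))

    image⊆E₂ : Span imageBasis ⊆ E M₂
    image⊆E₂ {y} (y∈ , y≢0) with ∈span-trans image⊆span y∈
    ... | d , d↦y = subst (E M₂) π₂x≡y ([ ⊥-elim ∘ π₂x≢0 ∘ proj₁ , proj₁ ] (E⊗⁻ M₁ M₂ x∈E))
      where
      π₂x≡y : π₂ (lincomb d b) ≡ y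
      π₂x≡y = trans (sym (lincomb-map π₂ π₂-+ d b)) d↦y
      π₂x≢0 : π₂ (lincomb d b) ≢ 0v
      π₂x≢0 = y≢0 ∘ trans (sym π₂x≡y)
      x∈E : E (M₁ ⊗ M₂) (lincomb d b)
      x∈E = span⊆E (d , refl) (π₂≢0v⇒≢0v π₂x≢0)

  IsOmega-⊗ : ∀ w₁ w₂ → IsOmega M₁ w₁ → IsOmega M₂ w₂ → IsOmega (M₁ ⊗ M₂) (w₁ + w₂)
  IsOmega-⊗ w₁ w₂ (flat₁ , maximal₁) (flat₂ , maximal₂) = FlatOfDimIn-⊗ flat₁ flat₂ , maximal
    where
    maximal : ∀ F j → IsFlat F → F ⊆ E (M₁ ⊗ M₂) → HasDim F j → j ≤ w₁ + w₂
    maximal F j _ F⊆E dim with FlatOfDimIn-⊗-split F⊆E dim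
    ... | k , l , refl , (F₁ , fl₁ , F₁⊆E₁ , dim₁) , (F₂ , fl₂ , F₂⊆E₂ , dim₂) =
      +-mono-≤ (maximal₁ F₁ k fl₁ F₁⊆E₁ dim₁) (maximal₂ F₂ l fl₂ F₂⊆E₂ dim₂)

∸+∸≡+∸+ : ∀ {d₁ d₂ o₁ o₂} → o₁ ≤ d₁ → o₂ ≤ d₂ → (d₁ ∸ o₁) + (d₂ ∸ o₂) ≡ (d₁ + d₂) ∸ (o₁ + o₂)
∸+∸≡+∸+ {d₁} {d₂} {o₁} {o₂} o₁≤d₁ o₂≤d₂ = begin
  (d₁ ∸ o₁) + (d₂ ∸ o₂)   ≡⟨ sym (+-∸-assoc (d₁ ∸ o₁) o₂≤d₂) ⟩
  (d₁ ∸ o₁ + d₂) ∸ o₂     ≡⟨ cong (_∸ o₂) (sym (+-∸-comm d₂ o₁≤d₁)) ⟩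
  (d₁ + d₂) ∸ o₁ ∸ o₂     ≡⟨ ∸-+-assoc (d₁ + d₂) o₁ o₂ ⟩
  (d₁ + d₂) ∸ (o₁ + o₂)   ∎
  where open ≡-Reasoning

IsChi-⊗ : ∀ {n₁ n₂} {M₁ : Matroid n₁} {M₂ : Matroid n₂} → IsMatroid M₁ → IsMatroid M₂ →
          ∀ c₁ c₂ → IsChi M₁ c₁ → IsChi M₂ c₂ → IsChi (M₁ ⊗ M₂) (c₁ + c₂)
IsChi-⊗ {n₁} {n₂} {M₁} {M₂} m₁ m₂ _ _ (d₁ , o₁ , dim₁ , ω₁ , refl) (d₂ , o₂ , dim₂ , ω₂ , refl) =
  d₁ + d₂ , o₁ + o₂ , DirectSum.⊕G-hasDim n₁ n₂ dim₁ dim₂ ,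
  IsOmega-resp-≐ {M = (M₁ ᶜ) ⊗ (M₂ ᶜ)} {N = (M₁ ⊗ M₂) ᶜ} (≐-sym (proj₁ (⊗-ᶜ m₁ m₂)))
    (IsOmega-⊗ (IsMatroid-ᶜ m₁) (IsMatroid-ᶜ m₂) o₁ o₂ ω₁ ω₂) ,
  ∸+∸≡+∸+ (IsOmega-ᶜ≤IsDim dim₁ ω₁) (IsOmega-ᶜ≤IsDim dim₂ ω₂)

lemma2p7 : ∀ {n₁ n₂} (M₁ : Matroid n₁) (M₂ : Matroid n₂)
    → IsMatroid M₁ → IsMatroid M₂
    → (((M₁ ⊗ M₂) ᶜ) ≈M ((M₁ ᶜ) ⊗ (M₂ ᶜ)))
    × (∀ F₁ F₂ → IsFlatOf F₁ (G M₁) → IsFlatOf F₂ (G M₂)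
         → ((M₁ ⊗ M₂) ∣ cl (ι₁ {n₁} {n₂} F₁ ∪ ι₂ {n₁} {n₂} F₂))
             ≈M ((M₁ ∣ F₁) ⊗ (M₂ ∣ F₂)))
    × (∀ w₁ w₂ → IsOmega M₁ w₁ → IsOmega M₂ w₂ → IsOmega (M₁ ⊗ M₂) (w₁ + w₂))
    × (∀ c₁ c₂ → IsChi M₁ c₁ → IsChi M₂ c₂ → IsChi (M₁ ⊗ M₂) (c₁ + c₂))
lemma2p7 M₁ M₂ m₁ m₂ = ⊗-ᶜ m₁ m₂ , ⊗-∣cl m₁ m₂ , IsOmega-⊗ m₁ m₂ , IsChi-⊗ m₁ m₂
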